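{- Let $X$ be a pairwise balanced design and let $e$ be an idempotent in the Wilson monoid $W(X)$. Then the image of $e$ is a subsystem of $X$.
   Context: A PBD is a pair $(S,\mathcal{L})$ with $S$ finite and $\mathcal{L}$ a set of subsets (blocks) of size at least 2 such that every pair of distinct points lies in exactly one block (degenerate cases with fewer than two blocks excluded). A subsystem is a set $F\subseteq S$ such that for all distinct $x,y\in F$ the block containing them is contained in $F$. For a partial function $f:S\to S$ put $f^{ -w}(B)=f^{ -1}(B)\cup(S\setminus Dom(f))$. $W(X)$ is the monoid under composition of all partial functions $f:S\to S$ such that $f^{ -w}(F)$ is a subsystem for every subsystem $F$. -}

module Defs where

open import Data.Nat using (ℕ; _≤_)
open import Data.Fin using (Fin)
open import Data.Fin.Subset using (Subset; _∈_; _⊆_; ∣_∣)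
open import Data.Maybe using (Maybe; just; nothing; _>>=_)
open import Data.Product using (Σ; ∃; _×_; _,_)
open import Relation.Binary.PropositionalEquality using (_≡_; _≢_)
open import Data.Sum using (_⊎_)

record IsPBD (n m : ℕ) (block : Fin m → Subset n) : Set where
  field
    atLeastTwoBlocks : 2 ≤ m
    blockSize        : ∀ b → 2 ≤ ∣ block b ∣
    pairCovered      : ∀ (x y : Fin n) → x ≢ y → ∃ λ b → x ∈ block b × y ∈ block b
    pairUnique       : ∀ (x y : Fin n) → x ≢ y → ∀ b c →
                       x ∈ block b → y ∈ block b → x ∈ block c → y ∈ block c → b ≡ c

IsSubsystem : ∀ {n m} → (Fin m → Subset n) → (Fin n → Set) → Set
IsSubsystem {n} {m} block F =
  ∀ (x y : Fin n) → F x → F y → x ≢ y →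
  ∀ (b : Fin m) → x ∈ block b → y ∈ block b →
  ∀ (z : Fin n) → z ∈ block b → F z

PFun : ℕ → Set
PFun n = Fin n → Maybe (Fin n)

_∘ₚ_ : ∀ {n} → PFun n → PFun n → PFun n
(f ∘ₚ g) x = g x >>= f

weakPreimage : ∀ {n} → PFun n → Subset n → Fin n → Set
weakPreimage f F x = (f x ≡ nothing) ⊎ (∃ λ y → f x ≡ just y × y ∈ F)

InWilson : ∀ {n m} → (Fin m → Subset n) → PFun n → Set
InWilson {n} block f =
  ∀ (F : Subset n) → IsSubsystem block (λ x → x ∈ F) →
  IsSubsystem block (weakPreimage f F)

IsIdempotent : ∀ {n} → PFun n → Set
IsIdempotent {n} e = ∀ (x : Fin n) → (e ∘ₚ e) x ≡ e x

Image : ∀ {n} → PFun n → Fin n → Set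
Image e y = ∃ λ x → e x ≡ just y

module Submission where

-- Every point in the image of an idempotent e is a fixed point.
-- Let x ≠ y be fixed points on a block b; we show every z ∈ b is fixed, so
-- in particular lies in Image e.  The key tool is the collapse lemma: if two
-- distinct points u, v of b lie in the weak preimage of a singleton {w} (a
-- subsystem), then the whole block b lies in that weak preimage, so every
-- fixed point of e on b equals w.  As b carries the two fixed points x ≠ y,
-- no such u, v, w exist (noCollapse).
--   * If e z is undefined, then z ≠ x and u = x, v = z, w = x is excluded.
--   * If e z = w, then w ∈ b (the weak preimage of the subsystem b contains
--     x and y, hence z), w is fixed, and z ≠ w would make u = w, v = z
--     a forbidden pair; hence z = w is fixed.

open import Defs
open import Data.Nat using (ℕ)
open import Data.Fin using (Fin; _≟_)
open import Data.Fin.Subset using (Subset; ⁅_⁆; _∈_)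
open import Data.Fin.Subset.Properties using (x∈⁅x⁆; x∈⁅y⁆⇒x≡y)
open import Data.Maybe using (just; nothing)
open import Data.Maybe.Properties using (just-injective)
open import Data.Product using (_,_)
open import Data.Sum using (inj₁; inj₂)
open import Data.Empty using (⊥; ⊥-elim)
open import Relation.Nullary using (yes; no)
open import Relation.Binary.PropositionalEquality
open import Function using (_∘_)

singletonSubsystem : ∀ {n m} (block : Fin m → Subset n) (w : Fin n) →
                     IsSubsystem block (λ x → x ∈ ⁅ w ⁆)
singletonSubsystem block w x y x∈w y∈w x≢y _ _ _ _ _ =
  ⊥-elim (x≢y (trans (x∈⁅y⁆⇒x≡y w x∈w) (sym (x∈⁅y⁆⇒x≡y w y∈w))))

-- In a PBD every block is a subsystem: two distinct points of b lie on no
-- other block.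
blockSubsystem : ∀ {n m} (block : Fin m → Subset n) → IsPBD n m block →
                 ∀ b → IsSubsystem block (λ x → x ∈ block b)
blockSubsystem block pbd b x y x∈b y∈b x≢y c x∈c y∈c z z∈c =
  subst (λ c → z ∈ block c) (IsPBD.pairUnique pbd x y x≢y c b x∈c y∈c x∈b y∈b) z∈c

imageFixed : ∀ {n} (e : PFun n) → IsIdempotent e →
             ∀ a v → e a ≡ just v → e v ≡ just v
imageFixed e idem a v ea with idem a
... | eea rewrite ea = eea

valueInPreimage : ∀ {n} (e : PFun n) (F : Subset n) {t s : Fin n} →
                  e t ≡ just s → s ∈ F → weakPreimage e F t
valueInPreimage e F {s = s} et s∈F = inj₂ (s , et , s∈F)

valueInSet : ∀ {n} (e : PFun n) (F : Subset n) {t s : Fin n} →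
             e t ≡ just s → weakPreimage e F t → s ∈ F
valueInSet e F et (inj₁ et-undef) with () ← trans (sym et) et-undef
valueInSet e F et (inj₂ (s' , et' , s'∈F)) =
  subst (_∈ F) (just-injective (trans (sym et') et)) s'∈F

collapse : ∀ {n m} (block : Fin m → Subset n) (e : PFun n) → InWilson block e →
           ∀ b w u v → u ≢ v → u ∈ block b → v ∈ block b →
           weakPreimage e ⁅ w ⁆ u → weakPreimage e ⁅ w ⁆ v →
           ∀ t s → t ∈ block b → e t ≡ just s → s ≡ w
collapse block e W b w u v u≢v u∈b v∈b u↦w v↦w t s t∈b et =
  x∈⁅y⁆⇒x≡y w (valueInSet e ⁅ w ⁆ et t↦w)
  where
  t↦w : weakPreimage e ⁅ w ⁆ t
  t↦w = W ⁅ w ⁆ (singletonSubsystem block w) u v u↦w v↦w u≢v b u∈b v∈b t t∈b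

noCollapse : ∀ {n m} (block : Fin m → Subset n) (e : PFun n) → InWilson block e →
             ∀ b x y → x ≢ y → x ∈ block b → y ∈ block b →
             e x ≡ just x → e y ≡ just y →
             ∀ w u v → u ≢ v → u ∈ block b → v ∈ block b →
             weakPreimage e ⁅ w ⁆ u → weakPreimage e ⁅ w ⁆ v → ⊥
noCollapse block e W b x y x≢y x∈b y∈b ex ey w u v u≢v u∈b v∈b u↦w v↦w =
  x≢y (trans (toW x x x∈b ex) (sym (toW y y y∈b ey)))
  where
  toW : ∀ t s → t ∈ block b → e t ≡ just s → s ≡ w
  toW = collapse block e W b w u v u≢v u∈b v∈b u↦w v↦w

blockOfFixedPointsFixed :
  ∀ {n m} (block : Fin m → Subset n) → IsPBD n m block →
  ∀ (e : PFun n) → InWilson block e → IsIdempotent e →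
  ∀ b x y → x ≢ y → x ∈ block b → y ∈ block b → e x ≡ just x → e y ≡ just y →
  ∀ z → z ∈ block b → e z ≡ just z
blockOfFixedPointsFixed block pbd e W idem b x y x≢y x∈b y∈b ex ey z z∈b
  with e z in ez
... | nothing = ⊥-elim (clash x x z x≢z x∈b z∈b
                          (valueInPreimage e ⁅ x ⁆ ex (x∈⁅x⁆ x)) (inj₁ ez))
  where
  clash : ∀ w u v → u ≢ v → u ∈ block b → v ∈ block b →
          weakPreimage e ⁅ w ⁆ u → weakPreimage e ⁅ w ⁆ v → ⊥
  clash = noCollapse block e W b x y x≢y x∈b y∈b ex ey
  x≢z : x ≢ z
  x≢z refl with () ← trans (sym ex) ez
... | just w with z ≟ w
...   | yes refl = refl
...   | no z≢w = ⊥-elim (clash w w z (z≢w ∘ sym) w∈b z∈b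
                           (valueInPreimage e ⁅ w ⁆ ew (x∈⁅x⁆ w))
                           (valueInPreimage e ⁅ w ⁆ ez (x∈⁅x⁆ w)))
  where
  clash : ∀ w u v → u ≢ v → u ∈ block b → v ∈ block b →
          weakPreimage e ⁅ w ⁆ u → weakPreimage e ⁅ w ⁆ v → ⊥
  clash = noCollapse block e W b x y x≢y x∈b y∈b ex ey
  ew : e w ≡ just w
  ew = imageFixed e idem z w ez
  -- w ∈ b: z lies in the weak preimage of the subsystem b, as x and y do.
  w∈b : w ∈ block b
  w∈b = valueInSet e (block b) ez
          (W (block b) (blockSubsystem block pbd b) x y
             (valueInPreimage e (block b) ex x∈b) (valueInPreimage e (block b) ey y∈b)
             x≢y b x∈b y∈b z z∈b)

lemma7p3 : ∀ (n m : ℕ) (block : Fin m → Subset n) → IsPBD n m block →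
           ∀ (e : PFun n) → InWilson block e → IsIdempotent e →
           IsSubsystem block (Image e)
lemma7p3 n m block pbd e W idem x y (a , ea) (c , ec) x≢y b x∈b y∈b z z∈b =
  z , blockOfFixedPointsFixed block pbd e W idem b x y x≢y x∈b y∈b
        (imageFixed e idem a x ea) (imageFixed e idem c y ec) z z∈b
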